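{- Let $m$ and $n$ be integers greater than $2$. Then $F(C_m \boxtimes C_n) \geq \left\lceil \frac{mn}{2} \right\rceil$.
   Context: All graphs are simple, finite and undirected; $C_k$ is the cycle on $k$ vertices. The strong product $G \boxtimes H$ has vertex set $V(G)\times V(H)$, with $(u,v)$ adjacent to $(u',v')$ iff ($uu'\in E(G)$ and $vv'\in E(H)$), or ($u=u'$ and $vv'\in E(H)$), or ($v=v'$ and $uu'\in E(G)$). Zero forcing: each vertex is blue or white; starting from an initial set $S$ of blue vertices, repeatedly apply the color-change rule: if a blue vertex $u$ has exactly one white neighbor $v$, color $v$ blue. $S$ is a zero forcing set if eventually all vertices are blue, and a failed zero forcing set otherwise. $F(G)$ denotes the maximum cardinality of a failed zero forcing set of $G$. -}

module Defs where

open import Level using (Level; _⊔_) renaming (suc to lsuc; zero to lzero)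
open import Data.Nat using (ℕ; _+_)
open import Data.Fin using (Fin; toℕ)
open import Data.Product using (_×_; _,_)
open import Data.Sum using (_⊎_)
open import Data.List using (List; length)
open import Data.List.Membership.Propositional using (_∈_)
open import Data.List.Relation.Unary.Unique.Propositional using (Unique)
open import Relation.Binary.PropositionalEquality using (_≡_; _≢_)
open import Relation.Nullary using (¬_)

record Graph (V : Set) : Set₁ where
  field
    Adj : V → V → Set

open Graph public

-- The cycle C_m on vertices Fin m: i ~ j iff j ≡ i+1 (mod m) or i ≡ j+1 (mod m).
-- (For m ≥ 3 this is the simple cycle on m vertices.)
-- Succ m i j : j is the successor of i in the cyclic order 0,1,…,m-1,0.
Succ : (m : ℕ) → Fin m → Fin m → Set
Succ m i j = (toℕ j ≡ toℕ i + 1) ⊎ ((toℕ i + 1 ≡ m) × (toℕ j ≡ 0))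

cycleAdj : (m : ℕ) → Fin m → Fin m → Set
cycleAdj m i j = Succ m i j ⊎ Succ m j i

C : (m : ℕ) → Graph (Fin m)
C m = record { Adj = cycleAdj m }

_⊠_ : {U W : Set} → Graph U → Graph W → Graph (U × W)
_⊠_ G H = record { Adj = adj }
  where
  adj : _ → _ → Set
  adj (u , v) (u' , v') =
    (Adj G u u' × Adj H v v') ⊎ ((u ≡ u' × Adj H v v') ⊎ (v ≡ v' × Adj G u u'))

-- Vertices coloured blue at the end of the zero forcing process started from S:
-- the least set containing S and closed under the colour-change rule
-- (a blue vertex u all of whose neighbours other than v are blue forces its neighbour v).
data Blue {V : Set} (G : Graph V) (S : List V) : V → Set where
  initial : ∀ {v} → v ∈ S → Blue G S v
  force   : ∀ {u v} → Blue G S u → Adj G u v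
          → (∀ w → Adj G u w → w ≢ v → Blue G S w)
          → Blue G S v

IsZeroForcingSet : {V : Set} → Graph V → List V → Set
IsZeroForcingSet G S = ∀ v → Blue G S v

IsFailedZeroForcingSet : {V : Set} → Graph V → List V → Set
IsFailedZeroForcingSet G S = Unique S × ¬ IsZeroForcingSet G S

-- F(G) ≥ k  :⇔  some failed zero forcing set has cardinality at least k
-- (F(G) is the maximum cardinality of a failed zero forcing set).
open import Data.Nat using (_≤_)
open import Data.Product using (Σ)
F≥ : {V : Set} → Graph V → ℕ → Set
F≥ {V} G k = Σ (List V) λ S → IsFailedZeroForcingSet G S × (k ≤ length S)

-- The whole row V(C_m) × {0} is a fort of C_m ⊠ C_n: a vertex (a, b) off the row that sees
-- the row has b adjacent to 0, hence sees both (a, 0) and (a′, 0) for a neighbour a′ of a.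
-- No blue vertex ever forces into a fort, so the m(n - 1) vertices off the row form a failed
-- zero forcing set, and m(n - 1) ≥ mn/2 as soon as n ≥ 2.
module Submission where

open import Defs
open import Data.Nat using (ℕ; zero; suc; _+_; _*_; _<_; _≤_; s≤s; ⌈_/2⌉)
open import Data.Nat.Properties
  using ( ≤-trans; ≤-reflexive; module ≤-Reasoning; +-comm; *-suc; m≤m*n; +-monoˡ-≤
        ; ⌈n/2⌉-mono; n≡⌈n+n/2⌉; 1+n≢n)
open import Data.Fin using (Fin; toℕ; inject₁) renaming (zero to fzero; suc to fsuc)
open import Data.Fin.Properties using (_≟_; toℕ-inject₁)
open import Data.Product using (Σ; _×_; _,_; proj₁; proj₂)
open import Data.Sum using (_⊎_; inj₁; inj₂)
open import Data.List using (List; _∷_; []; map; length; allFin; cartesianProductWith)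
open import Data.List.Properties using (length-++; length-map; length-tabulate)
open import Data.List.Membership.Propositional using (_∈_)
open import Data.List.Membership.Propositional.Properties using (∈-cartesianProductWith⁻)
open import Data.List.Relation.Unary.Unique.Propositional using (Unique)
open import Data.List.Relation.Unary.Unique.Propositional.Properties
  using (cartesianProductWith⁺; allFin⁺)
open import Function using (_∘_; id)
open import Relation.Binary.Definitions using (DecidableEquality)
open import Relation.Nullary using (¬_; yes; no; contradiction)
open import Relation.Binary.PropositionalEquality
  using (_≡_; _≢_; refl; sym; trans; cong; cong₂)

module _ {V : Set} (G : Graph V) where

  Fort : (V → Set) → Set
  Fort W = ∀ {u v} → ¬ W u → W v → Adj G u v → Σ V λ w → Adj G u w × w ≢ v × W w

  HasNoIsolatedVertex : Set
  HasNoIsolatedVertex = ∀ v → Σ V λ w → Adj G v w × w ≢ v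

  module _ {W : V → Set} (fort : Fort W) {S : List V} (S∩W≡∅ : ∀ {v} → v ∈ S → ¬ W v) where

    Blue⇒∉fort : ∀ {v} → Blue G S v → ¬ W v
    Blue⇒∉fort (initial v∈S) = S∩W≡∅ v∈S
    Blue⇒∉fort (force blue-u u~v others-blue) v∈W with fort (Blue⇒∉fort blue-u) v∈W u~v
    ... | w , u~w , w≢v , w∈W = Blue⇒∉fort (others-blue w u~w w≢v) w∈W

    fort-complement-fails : ∀ {v} → W v → ¬ IsZeroForcingSet G S
    fort-complement-fails v∈W all-blue = Blue⇒∉fort (all-blue _) v∈W

module _ {U V : Set} {G : Graph U} {H : Graph V} where

  ⊠-adj-proj₂ : ∀ {a b c d} → Adj (G ⊠ H) (a , b) (c , d) → b ≡ d ⊎ Adj H b d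
  ⊠-adj-proj₂ (inj₁ (_ , b~d))        = inj₂ b~d
  ⊠-adj-proj₂ (inj₂ (inj₁ (_ , b~d))) = inj₂ b~d
  ⊠-adj-proj₂ (inj₂ (inj₂ (b≡d , _))) = inj₁ b≡d

  full-×-fort : DecidableEquality U → HasNoIsolatedVertex G →
                (B : V → Set) → Fort (G ⊠ H) (B ∘ proj₂)
  full-×-fort _≟U_ no-isolated B {a , b} {c , d} b∉B d∈B u~v
    with ⊠-adj-proj₂ u~v | no-isolated a
  ... | inj₁ refl  | _ = contradiction d∈B b∉B
  ... | inj₂ b~d | a′ , a~a′ , a′≢a with c ≟U a
  ...   | yes refl = (a′ , d) , inj₁ (a~a′ , b~d) , a′≢a ∘ cong proj₁ , d∈B
  ...   | no c≢a   = (a , d) , inj₂ (inj₁ (refl , b~d)) , c≢a ∘ sym ∘ cong proj₁ , d∈B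

cycle-has-no-isolated-vertex : ∀ {m} → HasNoIsolatedVertex (C (suc (suc m)))
cycle-has-no-isolated-vertex fzero    = fsuc fzero , inj₁ (inj₁ refl) , λ ()
cycle-has-no-isolated-vertex (fsuc i) = inject₁ i , inj₂ (inj₁ suc-i≡i+1) , inject₁-i≢suc-i
  where
  suc-i≡i+1 : suc (toℕ i) ≡ toℕ (inject₁ i) + 1
  suc-i≡i+1 = trans (cong suc (sym (toℕ-inject₁ i))) (+-comm 1 _)
  inject₁-i≢suc-i : inject₁ i ≢ fsuc i
  inject₁-i≢suc-i eq = 1+n≢n (trans (sym (cong toℕ eq)) (toℕ-inject₁ i))

F≥-weaken : {V : Set} {G : Graph V} {k l : ℕ} → k ≤ l → F≥ G l → F≥ G k
F≥-weaken k≤l (S , failed , l≤|S|) = S , failed , ≤-trans k≤l l≤|S|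

length-cartesianProductWith : {A B X : Set} (f : A → B → X) (xs : List A) (ys : List B) →
                              length (cartesianProductWith f xs ys) ≡ length xs * length ys
length-cartesianProductWith f []       ys = refl
length-cartesianProductWith f (x ∷ xs) ys = trans (length-++ (map (f x) ys))
  (cong₂ _+_ (length-map (f x) ys) (length-cartesianProductWith f xs ys))

module _ (m n : ℕ) where

  offRow₀ : List (Fin m × Fin (suc n))
  offRow₀ = cartesianProductWith (λ i j → i , fsuc j) (allFin m) (allFin n)

  offRow₀-unique : Unique offRow₀
  offRow₀-unique = cartesianProductWith⁺ _ (λ { refl → refl , refl }) (allFin⁺ m) (allFin⁺ n)

  offRow₀-avoids-row₀ : ∀ {v} → v ∈ offRow₀ → proj₂ v ≢ fzero
  offRow₀-avoids-row₀ v∈S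
    with ∈-cartesianProductWith⁻ (λ i j → i , fsuc j) (allFin m) (allFin n) v∈S
  ... | _ , _ , _ , _ , refl = λ ()

  length-offRow₀ : length offRow₀ ≡ m * n
  length-offRow₀ = trans (length-cartesianProductWith _ (allFin m) (allFin n))
                         (cong₂ _*_ (length-tabulate {n = m} id) (length-tabulate {n = n} id))

F≥-⊠ : ∀ {k n} {G : Graph (Fin (suc k))} (H : Graph (Fin (suc n))) →
       HasNoIsolatedVertex G → F≥ (G ⊠ H) (suc k * n)
F≥-⊠ {k} {n} {G} H no-isolated =
  offRow₀ (suc k) n
  , (offRow₀-unique _ n , fort-complement-fails (G ⊠ H) row₀-fort (offRow₀-avoids-row₀ _ n)
                            {fzero , fzero} refl)
  , ≤-reflexive (sym (length-offRow₀ _ n))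
  where
  row₀-fort : Fort (G ⊠ H) ((_≡ fzero) ∘ proj₂)
  row₀-fort = full-×-fort {H = H} _≟_ no-isolated (_≡ fzero)

⌈m*[2+n]/2⌉≤m*[1+n] : ∀ m n → ⌈ m * suc (suc n) /2⌉ ≤ m * suc n
⌈m*[2+n]/2⌉≤m*[1+n] m n = begin
  ⌈ m * suc (suc n) /2⌉          ≡⟨ cong ⌈_/2⌉ (*-suc m (suc n)) ⟩
  ⌈ m + m * suc n /2⌉            ≤⟨ ⌈n/2⌉-mono (+-monoˡ-≤ (m * suc n) (m≤m*n m (suc n))) ⟩
  ⌈ m * suc n + m * suc n /2⌉    ≡⟨ n≡⌈n+n/2⌉ (m * suc n) ⟨
  m * suc n                      ∎
  where open ≤-Reasoning

theorem3p11 : (m n : ℕ) → 2 < m → 2 < n →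
    F≥ (C m ⊠ C n) ⌈ m * n /2⌉
theorem3p11 (suc (suc m)) (suc (suc n)) _ _ =
  F≥-weaken (⌈m*[2+n]/2⌉≤m*[1+n] (suc (suc m)) n)
            (F≥-⊠ (C (suc (suc n))) (cycle-has-no-isolated-vertex {m}))
theorem3p11 (suc zero) _ (s≤s ()) _
theorem3p11 (suc (suc m)) (suc zero) _ (s≤s ())
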